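{- Let $n>1$ and let $H=(h_{ij})$ be an $n\times n$ symmetric matrix with entries in $\{+1,-1\}$ satisfying $HH^{T}=nI$, with all diagonal entries equal to $+1$ and all row sums equal to a common positive constant. Let $G$ be the graph with vertex set $\{1,\dots,n\}$ in which distinct $i,j$ are adjacent if and only if $h_{ij}=+1$. Then $n$ is even and $G\in\mathfrak{Gr}(n,n/2+1)$.
   Context: All graphs are finite, simple and undirected. For a graph $G=(V,E)$ and $x\in V$, $N[x]=\{x\}\cup\{y: xy\in E\}$. A set $C\subseteq V$ is identifying if $N[x]\cap C\ne\emptyset$ for every $x\in V$ and $N[x]\cap C\neq N[y]\cap C$ for all distinct $x,y\in V$. For $n\ge k\ge1$, $\mathfrak{Gr}(n,k)$ is the set of graphs on $n$ vertices in which every $k$-element subset of vertices is identifying. -}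

module Defs where

open import Data.Nat using (ℕ; zero; suc)
open import Data.Integer using (ℤ; +_; -[1+_]; _+_; _*_; _>_)
open import Data.Fin using (Fin)
open import Data.Fin.Subset using (Subset; _∈_; ∣_∣)
open import Data.Vec.Functional using (foldr)
open import Data.Product using (Σ; _×_; ∃; _,_)
open import Data.Sum using (_⊎_)
open import Relation.Nullary using (¬_)
open import Relation.Binary.PropositionalEquality using (_≡_)
import Relation.Binary.PropositionalEquality as Eq

Matrix : ℕ → Set
Matrix n = Fin n → Fin n → ℤ

Σℤ : ∀ {n} → (Fin n → ℤ) → ℤ
Σℤ f = foldr _+_ (+ 0) f

IsPM1 : ∀ {n} → Matrix n → Set
IsPM1 H = ∀ i j → (H i j ≡ + 1) ⊎ (H i j ≡ -[1+ 0 ])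

Symmetric : ∀ {n} → Matrix n → Set
Symmetric H = ∀ i j → H i j ≡ H j i

HHᵀ≡nI : ∀ {n} → Matrix n → Set
HHᵀ≡nI {n} H =
  (∀ i → Σℤ (λ k → H i k * H i k) ≡ + n) ×
  (∀ i j → ¬ (i ≡ j) → Σℤ (λ k → H i k * H j k) ≡ + 0)

DiagonalOnes : ∀ {n} → Matrix n → Set
DiagonalOnes H = ∀ i → H i i ≡ + 1

ConstantPositiveRowSums : ∀ {n} → Matrix n → Set
ConstantPositiveRowSums H = Σ ℤ (λ c → (c > + 0) × (∀ i → Σℤ (H i) ≡ c))

record Graph (n : ℕ) : Set₁ where
  field
    Adj     : Fin n → Fin n → Set
    sym     : ∀ {x y} → Adj x y → Adj y x
    irrefl  : ∀ {x} → ¬ Adj x x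

open Graph public

InClosedNbhd : ∀ {n} → Graph n → Fin n → Fin n → Set
InClosedNbhd G x y = (y ≡ x) ⊎ Adj G x y

SameTrace : ∀ {n} → Graph n → Subset n → Fin n → Fin n → Set
SameTrace G C x y =
  ∀ c → c ∈ C → (InClosedNbhd G x c → InClosedNbhd G y c) × (InClosedNbhd G y c → InClosedNbhd G x c)

Identifying : ∀ {n} → Graph n → Subset n → Set
Identifying G C =
  (∀ x → ∃ λ c → InClosedNbhd G x c × c ∈ C) ×
  (∀ x y → ¬ (x ≡ y) → ¬ SameTrace G C x y)

InGr : ∀ {n} → ℕ → Graph n → Set
InGr {n} k G = ∀ (C : Subset n) → ∣ C ∣ ≡ k → Identifying G C

graphOf : ∀ {n} (H : Matrix n) → Symmetric H → Graph n
graphOf H symH = record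
  { Adj    = λ i j → ¬ (i ≡ j) × (H i j ≡ + 1)
  ; sym    = λ { {x} {y} (x≢y , h) → (λ e → x≢y (Eq.sym e)) , Eq.trans (symH y x) h }
  ; irrefl = λ { (x≢x , _) → x≢x Eq.refl }
  }

-- Rows of H are ±1 vectors, so a row sum s counts its +1 entries p via s + n = 2p, and two
-- distinct (orthogonal) rows agree in exactly n/2 positions; in particular n is even.  A row
-- has more than n/2 entries +1 (its sum is positive) and two distinct rows disagree in n/2
-- positions, so by pigeonhole every set C of n/2 + 1 vertices meets both.  Since the diagonal
-- is +1, N[x] is the set of +1 positions of row x: C therefore meets N[x], and C contains a
-- position where rows x and y disagree, which lies in exactly one of N[x], N[y].
module Submission where

open import Defs
open import Data.Nat using (ℕ; _<_; _/_; _+_)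
open import Data.Nat.Divisibility using (_∣_)
open import Data.Product using (_×_)

open import Data.Nat as ℕ using (zero; suc; _*_; _∸_; _≤_; s≤s; z≤n)
import Data.Nat.Properties as ℕ
open import Data.Nat.DivMod using (m*n/n≡m)
open import Data.Nat.Divisibility using (divides)
open import Data.Integer as ℤ using (ℤ; +_; -[1+_]; +<+)
import Data.Integer.Properties as ℤ
open import Data.Integer.Tactic.RingSolver using (solve-∀)
open import Data.Fin using (Fin; zero; suc)
import Data.Fin.Properties as Fin
open import Data.Fin.Subset using (Subset; _∈_; ∣_∣; ∁; _∩_)
open import Data.Fin.Subset.Properties
  using (nonempty?; x∈p∩q⁺; x∈p∩q⁻; x∉p⇒x∈∁p; x∈∁p⇒x∉p; p⊆q⇒∣p∣≤∣q∣; ∣∁p∣≡n∸∣p∣; ∣p∣≤n)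
open import Data.Vec using (tabulate)
open import Data.Vec.Properties using (lookup∘tabulate; lookup⇒[]=; []=⇒lookup)
open import Data.Product using (∃; _,_)
open import Data.Sum using (_⊎_; inj₁; inj₂)
open import Relation.Nullary using (¬_; yes; no; does; contradiction)
open import Relation.Nullary.Decidable using (dec-true)
open import Relation.Binary.PropositionalEquality
  using (_≡_; _≢_; refl; trans; cong; subst; module ≡-Reasoning)
  renaming (sym to ≡-sym)

private
  variable
    n : ℕ

pigeonhole : (p q : Subset n) → n < ∣ p ∣ + ∣ q ∣ → ∃ λ k → k ∈ p × k ∈ q
pigeonhole {n} p q n<∣p∣+∣q∣ with nonempty? (p ∩ q)
... | yes (k , k∈p∩q) = k , x∈p∩q⁻ p q k∈p∩q
... | no p∩q-empty = contradiction n<∣p∣+∣q∣ (ℕ.≤⇒≯ ∣p∣+∣q∣≤n)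
  where
  q⊆∁p : ∀ {k} → k ∈ q → k ∈ ∁ p
  q⊆∁p {k} k∈q = x∉p⇒x∈∁p λ k∈p → p∩q-empty (k , x∈p∩q⁺ (k∈p , k∈q))

  ∣p∣+∣q∣≤n : ∣ p ∣ + ∣ q ∣ ≤ n
  ∣p∣+∣q∣≤n = begin
    ∣ p ∣ + ∣ q ∣        ≤⟨ ℕ.+-monoʳ-≤ ∣ p ∣ (p⊆q⇒∣p∣≤∣q∣ q⊆∁p) ⟩
    ∣ p ∣ + ∣ ∁ p ∣      ≡⟨ cong (λ s → ∣ p ∣ + s) (∣∁p∣≡n∸∣p∣ p) ⟩
    ∣ p ∣ + (n ∸ ∣ p ∣)  ≡⟨ ℕ.m+[n∸m]≡n (∣p∣≤n p) ⟩
    n                    ∎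
    where open ℕ.≤-Reasoning

IsSign : ℤ → Set
IsSign z = (z ≡ + 1) ⊎ (z ≡ -[1+ 0 ])

*-isSign : ∀ {a b} → IsSign a → IsSign b → IsSign (a ℤ.* b)
*-isSign (inj₁ refl) (inj₁ refl) = inj₁ refl
*-isSign (inj₁ refl) (inj₂ refl) = inj₂ refl
*-isSign (inj₂ refl) (inj₁ refl) = inj₂ refl
*-isSign (inj₂ refl) (inj₂ refl) = inj₁ refl

signs-differ : ∀ {a b} → IsSign a → IsSign b → a ℤ.* b ≢ + 1 →
  (a ≡ + 1 × b ≢ + 1) ⊎ (a ≢ + 1 × b ≡ + 1)
signs-differ (inj₁ refl) (inj₁ refl) ab≢1 = contradiction refl ab≢1
signs-differ (inj₁ refl) (inj₂ refl) _    = inj₁ (refl , λ ())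
signs-differ (inj₂ refl) (inj₁ refl) _    = inj₂ ((λ ()) , refl)
signs-differ (inj₂ refl) (inj₂ refl) ab≢1 = contradiction refl ab≢1

positives : (Fin n → ℤ) → Subset n
positives v = tabulate (λ k → does (v k ℤ.≟ + 1))

∈-positives⁺ : ∀ (v : Fin n → ℤ) {k} → v k ≡ + 1 → k ∈ positives v
∈-positives⁺ v {k} vk≡1 =
  lookup⇒[]= k _ (trans (lookup∘tabulate _ k) (dec-true (v k ℤ.≟ + 1) vk≡1))

∈-positives⁻ : ∀ (v : Fin n → ℤ) {k} → k ∈ positives v → v k ≡ + 1
∈-positives⁻ v {k} k∈ with v k ℤ.≟ + 1 | lookup∘tabulate (λ k → does (v k ℤ.≟ + 1)) k
... | yes vk≡1 | _ = vk≡1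
... | no  _    | eq = contradiction (trans (≡-sym eq) ([]=⇒lookup k∈)) λ ()

Σℤ-signs : (v : Fin n → ℤ) → (∀ k → IsSign (v k)) → Σℤ v ℤ.+ + n ≡ + (2 * ∣ positives v ∣)
Σℤ-signs {zero}  v _ = refl
Σℤ-signs {suc n} v sign with sign zero | Σℤ-signs (λ k → v (suc k)) (λ k → sign (suc k))
... | inj₁ v₀≡1 | ih rewrite v₀≡1 = begin
  (+ 1 ℤ.+ S) ℤ.+ + suc n  ≡⟨ plus S (+ n) ⟩
  + 2 ℤ.+ (S ℤ.+ + n)      ≡⟨ cong (λ s → + 2 ℤ.+ s) ih ⟩
  + (2 + 2 * a)            ≡⟨ cong +_ (ℕ.*-suc 2 a) ⟨
  + (2 * suc a)            ∎
  where
  open ≡-Reasoning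
  S = Σℤ (λ k → v (suc k))
  a = ∣ positives (λ k → v (suc k)) ∣
  plus : ∀ s m → (+ 1 ℤ.+ s) ℤ.+ (+ 1 ℤ.+ m) ≡ + 2 ℤ.+ (s ℤ.+ m)
  plus = solve-∀
... | inj₂ v₀≡-1 | ih rewrite v₀≡-1 = trans (minus (Σℤ (λ k → v (suc k))) (+ n)) ih
  where
  minus : ∀ s m → (-[1+ 0 ] ℤ.+ s) ℤ.+ (+ 1 ℤ.+ m) ≡ s ℤ.+ m
  minus = solve-∀

balanced-signs : (w : Fin n → ℤ) → (∀ k → IsSign (w k)) → Σℤ w ≡ + 0 → 2 * ∣ positives w ∣ ≡ n
balanced-signs {n} w sign Σw≡0 = ℤ.+-injective (begin
  + (2 * ∣ positives w ∣) ≡⟨ Σℤ-signs w sign ⟨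
  Σℤ w ℤ.+ + n            ≡⟨ cong (λ s → s ℤ.+ + n) Σw≡0 ⟩
  + n                     ∎)
  where open ≡-Reasoning

positive-signs : (w : Fin n → ℤ) → (∀ k → IsSign (w k)) → Σℤ w ℤ.> + 0 → n < 2 * ∣ positives w ∣
positive-signs {n} w sign Σw>0 with Σℤ w | Σℤ-signs w sign
positive-signs {n} w sign (+<+ _) | + suc j | Σw+n≡2p =
  subst (n <_) (ℤ.+-injective Σw+n≡2p) (ℕ.m<n+m n (s≤s z≤n))

∣∁p∣≡∣p∣ : (p : Subset n) → 2 * ∣ p ∣ ≡ n → ∣ ∁ p ∣ ≡ ∣ p ∣
∣∁p∣≡∣p∣ {n} p 2∣p∣≡n = begin
  ∣ ∁ p ∣                     ≡⟨ ∣∁p∣≡n∸∣p∣ p ⟩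
  n ∸ ∣ p ∣                   ≡⟨ cong (_∸ ∣ p ∣) 2∣p∣≡n ⟨
  ∣ p ∣ + (∣ p ∣ + 0) ∸ ∣ p ∣ ≡⟨ ℕ.m+n∸m≡n ∣ p ∣ (∣ p ∣ + 0) ⟩
  ∣ p ∣ + 0                   ≡⟨ ℕ.+-identityʳ ∣ p ∣ ⟩
  ∣ p ∣                       ∎
  where open ≡-Reasoning

meets-half : ∀ {m} (p C : Subset n) → 2 * m ≡ n → ∣ C ∣ ≡ suc m → m ≤ ∣ p ∣ →
  ∃ λ k → k ∈ p × k ∈ C
meets-half {n} {m} p C 2m≡n ∣C∣≡1+m m≤∣p∣ = pigeonhole p C (begin-strict
  n                ≡⟨ 2m≡n ⟨
  m + (m + 0)      <⟨ ℕ.+-mono-≤-< m≤∣p∣ (s≤s (ℕ.≤-reflexive (ℕ.+-identityʳ m))) ⟩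
  ∣ p ∣ + suc m    ≡⟨ cong (λ s → ∣ p ∣ + s) ∣C∣≡1+m ⟨
  ∣ p ∣ + ∣ C ∣    ∎)
  where open ℕ.≤-Reasoning

agreements : Matrix n → Fin n → Fin n → Subset n
agreements H x y = positives (λ k → H x k ℤ.* H y k)

agreements-half : ∀ {H : Matrix n} → IsPM1 H → ∀ {x y} →
  Σℤ (λ k → H x k ℤ.* H y k) ≡ + 0 → 2 * ∣ agreements H x y ∣ ≡ n
agreements-half pm {x} {y} = balanced-signs _ (λ k → *-isSign (pm x k) (pm y k))

2*m≡n⇒n/2≡m : ∀ {m} → 2 * m ≡ n → n / 2 ≡ m
2*m≡n⇒n/2≡m {n} {m} 2m≡n = begin
  n / 2      ≡⟨ cong (_/ 2) 2m≡n ⟨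
  2 * m / 2  ≡⟨ cong (_/ 2) (ℕ.*-comm 2 m) ⟩
  m * 2 / 2  ≡⟨ m*n/n≡m m 2 ⟩
  m          ∎
  where open ≡-Reasoning

module _ {H : Matrix n} (pm : IsPM1 H) (symH : Symmetric H) (diag : DiagonalOnes H) where

  private
    G : Graph n
    G = graphOf H symH

  closedNbhd⁺ : ∀ {x k} → H x k ≡ + 1 → InClosedNbhd G x k
  closedNbhd⁺ {x} {k} Hxk≡1 with k Fin.≟ x
  ... | yes k≡x = inj₁ k≡x
  ... | no  k≢x = inj₂ ((λ x≡k → k≢x (≡-sym x≡k)) , Hxk≡1)

  closedNbhd⁻ : ∀ {x k} → InClosedNbhd G x k → H x k ≡ + 1
  closedNbhd⁻ (inj₁ refl)            = diag _
  closedNbhd⁻ (inj₂ (_ , Hxk≡1)) = Hxk≡1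

  module _ {m} (2m≡n : 2 * m ≡ n) {C : Subset n} (∣C∣≡1+m : ∣ C ∣ ≡ suc m) where

    dominated : ∀ {x} → Σℤ (H x) ℤ.> + 0 → ∃ λ c → InClosedNbhd G x c × c ∈ C
    dominated {x} Σ>0 with meets-half (positives (H x)) C 2m≡n ∣C∣≡1+m m≤∣p∣
      where
      m≤∣p∣ : m ≤ ∣ positives (H x) ∣
      m≤∣p∣ = ℕ.<⇒≤ (ℕ.*-cancelˡ-< 2 m ∣ positives (H x) ∣
        (subst (λ s → s < 2 * ∣ positives (H x) ∣) (≡-sym 2m≡n) (positive-signs (H x) (pm x) Σ>0)))
    ... | c , c∈p , c∈C = c , closedNbhd⁺ (∈-positives⁻ (H x) c∈p) , c∈C

    separated : ∀ {x y} → Σℤ (λ k → H x k ℤ.* H y k) ≡ + 0 → ¬ SameTrace G C x y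
    separated {x} {y} orth same
      with meets-half (∁ (agreements H x y)) C 2m≡n ∣C∣≡1+m m≤∣∁A∣
      where
      ∣A∣≡m : ∣ agreements H x y ∣ ≡ m
      ∣A∣≡m = ℕ.*-cancelˡ-≡ ∣ agreements H x y ∣ m 2 (trans (agreements-half pm orth) (≡-sym 2m≡n))
      m≤∣∁A∣ : m ≤ ∣ ∁ (agreements H x y) ∣
      m≤∣∁A∣ = ℕ.≤-reflexive (≡-sym (trans (∣∁p∣≡∣p∣ (agreements H x y) (agreements-half pm orth)) ∣A∣≡m))
    ... | c , c∈∁A , c∈C
      with signs-differ (pm x c) (pm y c) (λ e → x∈∁p⇒x∉p c∈∁A (∈-positives⁺ (λ k → H x k ℤ.* H y k) e))
         | same c c∈C
    ... | inj₁ (Hxc≡1 , Hyc≢1) | x→y , _ = Hyc≢1 (closedNbhd⁻ (x→y (closedNbhd⁺ Hxc≡1)))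
    ... | inj₂ (Hxc≢1 , Hyc≡1) | _ , y→x = Hxc≢1 (closedNbhd⁻ (y→x (closedNbhd⁺ Hyc≡1)))

  inGr-half : ∀ {m} → 2 * m ≡ n → HHᵀ≡nI H → ConstantPositiveRowSums H → InGr (suc m) G
  inGr-half 2m≡n (_ , orth) (_ , c>0 , rowSum) C ∣C∣≡1+m =
      (λ x → dominated 2m≡n ∣C∣≡1+m (subst (ℤ._> + 0) (≡-sym (rowSum x)) c>0))
    , (λ x y x≢y → separated 2m≡n ∣C∣≡1+m (orth x y x≢y))

theorem29 : (n : ℕ) → 1 < n → (H : Matrix n) → IsPM1 H → (symH : Symmetric H) →
    HHᵀ≡nI H → DiagonalOnes H → ConstantPositiveRowSums H →
    (2 ∣ n) × InGr (n / 2 + 1) (graphOf H symH)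
theorem29 (suc (suc n)) (s≤s (s≤s z≤n)) H pm symH HHᵀ@(_ , orth) diag rowSums =
    divides m (trans (≡-sym 2m≡n) (ℕ.*-comm 2 m))
  , subst (λ k → InGr k (graphOf H symH)) (≡-sym n/2+1≡1+m) (inGr-half pm symH diag 2m≡n HHᵀ rowSums)
  where
  m : ℕ
  m = ∣ agreements H zero (suc zero) ∣
  2m≡n : 2 * m ≡ suc (suc n)
  2m≡n = agreements-half pm (orth zero (suc zero) λ ())
  n/2+1≡1+m : suc (suc n) / 2 + 1 ≡ suc m
  n/2+1≡1+m = trans (cong (_+ 1) (2*m≡n⇒n/2≡m 2m≡n)) (ℕ.+-comm m 1)
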